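{- Let $u\in\Sigma_3^\omega$ and suppose that for some positive integer $n$, one of $f(g(h^n(u)))$ and $f(h^n(u))$ is good. Then some suffix of $u$ contains none of the factors in the set $F=\{1221,\,00,\,10101,\,212,\,11\}$.
   Context: $\Sigma_k=\{0,1,\dots,k-1\}$. The morphisms $f:\Sigma_3^*\to\Sigma_2^*$ and $g,h:\Sigma_3^*\to\Sigma_3^*$ are defined by $f(0)=0$, $f(1)=01$, $f(2)=011$; $g(0)=011$, $g(1)=0121$, $g(2)=012121$; $h(0)=01$, $h(1)=02$, $h(2)=022$ (extended to infinite words letterwise). A finite word of length $n$ is rich if it has $n$ distinct nonempty palindromic factors; an infinite word is rich if all of its finite factors are rich. A word is $\alpha$-free if it has no nonempty factor $x$ with $|x|/p\ge\alpha$ for some period $p$ of $x$. A word in $\Sigma_2^\omega$ is called good if it is rich and $14/5$-free. -}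

module Defs where

open import Data.Nat using (ℕ; zero; suc; _+_; _*_; _<_; _≤_)
open import Data.Fin using (Fin; zero; suc)
open import Data.Fin.Properties using () renaming (_≟_ to _≟F_)
open import Data.List using (List; []; _∷_; _++_; length; concatMap; filter; reverse; deduplicate; map; upTo; drop; take)
open import Data.List.Properties using (≡-dec)
open import Data.List.Membership.Propositional using (_∈_)
open import Data.Product using (∃; _×_)
open import Relation.Binary.PropositionalEquality using (_≡_)
open import Relation.Nullary using (¬_)

Σ : ℕ → Set
Σ k = Fin k

Word : ℕ → Set
Word k = List (Σ k)

ωWord : ℕ → Set
ωWord k = ℕ → Σ k

-- A morphism Σ_a^* → Σ_b^* is determined by its images of letters
Morphism : ℕ → ℕ → Set
Morphism a b = Σ a → Word b

ext : ∀ {a b} → Morphism a b → Word a → Word b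
ext φ w = concatMap φ w

_∘ᴹ_ : ∀ {a b c} → Morphism b c → Morphism a b → Morphism a c
(φ ∘ᴹ ψ) x = ext φ (ψ x)

_^ᴹ_ : ∀ {a} → Morphism a a → ℕ → Morphism a a
φ ^ᴹ zero  = λ x → x ∷ []
φ ^ᴹ suc n = φ ∘ᴹ (φ ^ᴹ n)

factor : ∀ {k} → ωWord k → ℕ → ℕ → Word k
factor u i m = map (λ j → u (i + j)) (upTo m)

prefix : ∀ {k} → ωWord k → ℕ → Word k
prefix u m = factor u 0 m

lookupD : ∀ {k} → Σ k → Word k → ℕ → Σ k
lookupD d []       _       = d
lookupD d (x ∷ w)  zero    = x
lookupD d (x ∷ w)  (suc i) = lookupD d w i

-- Image of an infinite word under a NON-ERASING morphism, letterwise: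
-- the i-th letter of φ(u) is the i-th letter of φ(u_0 … u_i)
-- (which has length ≥ i+1 as φ is non-erasing; the default d is then never used).
applyω : ∀ {a b} → Morphism a b → Σ b → ωWord a → ωWord b
applyω φ d u i = lookupD d (ext φ (prefix u (suc i))) i

l0 : ∀ {k} → Fin (suc k)
l0 = zero
l1 : ∀ {k} → Fin (suc (suc k))
l1 = suc zero
l2 : ∀ {k} → Fin (suc (suc (suc k)))
l2 = suc (suc zero)

f : Morphism 3 2
f zero             = l0 ∷ []
f (suc zero)       = l0 ∷ l1 ∷ []
f (suc (suc zero)) = l0 ∷ l1 ∷ l1 ∷ []

g : Morphism 3 3
g zero             = l0 ∷ l1 ∷ l1 ∷ []
g (suc zero)       = l0 ∷ l1 ∷ l2 ∷ l1 ∷ []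
g (suc (suc zero)) = l0 ∷ l1 ∷ l2 ∷ l1 ∷ l2 ∷ l1 ∷ []

h : Morphism 3 3
h zero             = l0 ∷ l1 ∷ []
h (suc zero)       = l0 ∷ l2 ∷ []
h (suc (suc zero)) = l0 ∷ l2 ∷ l2 ∷ []

_≟W_ : ∀ {k} → (x y : Word k) → Relation.Nullary.Dec (x ≡ y)
_≟W_ = ≡-dec _≟F_

isPal? : ∀ {k} → (w : Word k) → Relation.Nullary.Dec (w ≡ reverse w)
isPal? w = w ≟W reverse w

nonemptyFactors : ∀ {k} → Word k → List (Word k)
nonemptyFactors w =
  concatMap (λ i → map (λ m → take (suc m) (drop i w)) (upTo (length w Data.Nat.∸ i))) (upTo (length w))

palCount : ∀ {k} → Word k → ℕ
palCount w = length (deduplicate _≟W_ (filter isPal? (nonemptyFactors w)))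

RichFin : ∀ {k} → Word k → Set
RichFin w = palCount w ≡ length w

Rich : ∀ {k} → ωWord k → Set
Rich u = ∀ i m → RichFin (factor u i m)

HasPeriod : ∀ {k} → ωWord k → ℕ → ℕ → ℕ → Set
HasPeriod u i m p = ∀ j → j + p < m → u (i + j) ≡ u (i + j + p)

-- 14/5-free: no nonempty factor x with |x|/p ≥ 14/5 for a period p ≥ 1 of x,
-- i.e. for every such factor, 5|x| < 14p
Free-14/5 : ∀ {k} → ωWord k → Set
Free-14/5 u = ∀ i m p → 1 ≤ m → 1 ≤ p → HasPeriod u i m p → 5 * m < 14 * p

Good : ωWord 2 → Set
Good v = Rich v × Free-14/5 v

F : List (Word 3)
F = (l1 ∷ l2 ∷ l2 ∷ l1 ∷ [])
  ∷ (l0 ∷ l0 ∷ [])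
  ∷ (l1 ∷ l0 ∷ l1 ∷ l0 ∷ l1 ∷ [])
  ∷ (l2 ∷ l1 ∷ l2 ∷ [])
  ∷ (l1 ∷ l1 ∷ [])
  ∷ []

SuffixAvoidsF : ωWord 3 → Set
SuffixAvoidsF u = ∃ λ k → ∀ w → w ∈ F → ∀ i → k ≤ i → ¬ (factor u i (length w) ≡ w)

-- Suppose w ∈ F occurs in u at a
-- position i ≥ 1, with neighbours a and b.  Then φ(a w b) is a factor of φ(u), where
-- φ = f∘g∘hⁿ or f∘hⁿ.  For n = 1, 2 a finite computation exhibits a factor of exponent
-- at least 14/5 in each φ(a w b).  For n ≥ 3 already h³(a w b) contains a cube; a
-- non-erasing morphism maps cubes to cubes, and a cube has exponent 3 > 14/5.  So no
-- word of F occurs in u from position 1 on.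
module Submission where

open import Defs
open import Data.Nat using (ℕ; zero; suc; _+_; _*_; _∸_; _/_; _≤_; _<_; _≤?_; z≤n; s≤s)
open import Data.Nat.Properties
open import Data.Nat.Tactic.RingSolver using (solve-∀)
open import Data.Fin using (zero; suc)
open import Data.Fin.Properties using (all?) renaming (_≟_ to _≟ᶠ_)
open import Data.Product using (∃; _×_; _,_; proj₁; proj₂; map₁; map₂)
open import Data.Sum using (_⊎_; inj₁; inj₂)
open import Data.List using (List; []; _∷_; _++_; length; map; upTo; applyUpTo; take; drop)
open import Data.List.Properties
  using (∷-injective; length-++; length-map; length-upTo; map-upTo; map-∘; map-cong;
         concatMap-++; concatMap-pure; ++-assoc; take++drop≡id)
open import Data.List.Membership.Propositional using (_∈_)
open import Data.List.Relation.Unary.Any using (here; there)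
open import Data.List.Relation.Binary.Pointwise using (Pointwise; []; _∷_; ≡⇒Pointwise-≡)
open import Data.List.Relation.Binary.Pointwise.Properties using () renaming (decidable to pointwise?)
open import Data.List.Relation.Binary.Prefix.Heterogeneous using (Prefix; []; _∷_; _++ᵖ_)
open import Data.List.Relation.Binary.Prefix.Heterogeneous.Properties using (prefix?; fromPointwise)
open import Relation.Nullary using (¬_; contradiction)
open import Relation.Nullary.Decidable using (Dec; True; toWitness; _×-dec_)
open import Relation.Binary.PropositionalEquality
open ≡-Reasoning

++-cancel-≡length : ∀ {A : Set} (xs ys : List A) {zs ws} →
  length xs ≡ length ys → xs ++ zs ≡ ys ++ ws → xs ≡ ys × zs ≡ ws
++-cancel-≡length []       []       _   eq = refl , eq
++-cancel-≡length (_ ∷ xs) (_ ∷ ys) len eq with ∷-injective eq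
... | refl , eq′ = map₁ (cong (_ ∷_)) (++-cancel-≡length xs ys (suc-injective len) eq′)

drop-length-++ : ∀ {A : Set} (xs : List A) {ys} → drop (length xs) (xs ++ ys) ≡ ys
drop-length-++ []       = refl
drop-length-++ (_ ∷ xs) = drop-length-++ xs

prefix⇒++ : ∀ {A : Set} {xs ys : List A} → Prefix _≡_ xs ys → ∃ λ zs → ys ≡ xs ++ zs
prefix⇒++ {ys = ys} []   = ys , refl
prefix⇒++ (refl ∷ pre) = map₂ (cong (_ ∷_)) (prefix⇒++ pre)

pointwise-∈ʳ : ∀ {A B : Set} {R : A → B → Set} {xs ys y} →
  Pointwise R xs ys → y ∈ ys → ∃ λ x → R x y
pointwise-∈ʳ (r ∷ _)  (here refl) = _ , r
pointwise-∈ʳ (_ ∷ rs) (there y∈) = pointwise-∈ʳ rs y∈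

lookupD-++ˡ : ∀ {k} (d : Σ k) xs ys {j} → j < length xs → lookupD d (xs ++ ys) j ≡ lookupD d xs j
lookupD-++ˡ d (_ ∷ xs) ys {zero}  _          = refl
lookupD-++ˡ d (_ ∷ xs) ys {suc j} (s≤s j<xs) = lookupD-++ˡ d xs ys j<xs

record NonErasing {a b} (φ : Morphism a b) : Set where
  constructor nonErasing
  field nonEmpty : ∀ x → 1 ≤ length (φ x)
open NonErasing

length-ext : ∀ {a b} {φ : Morphism a b} → NonErasing φ → ∀ w → length w ≤ length (ext φ w)
length-ext ne []              = z≤n
length-ext {φ = φ} ne (x ∷ w) =
  ≤-trans (+-mono-≤ (nonEmpty ne x) (length-ext ne w)) (≤-reflexive (sym (length-++ (φ x))))

∘ᴹ-nonErasing : ∀ {a b c} {φ : Morphism b c} {ψ : Morphism a b} →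
  NonErasing φ → NonErasing ψ → NonErasing (φ ∘ᴹ ψ)
∘ᴹ-nonErasing {ψ = ψ} neφ neψ = nonErasing λ x → ≤-trans (nonEmpty neψ x) (length-ext neφ (ψ x))

^ᴹ-nonErasing : ∀ {a} {φ : Morphism a a} → NonErasing φ → ∀ n → NonErasing (φ ^ᴹ n)
^ᴹ-nonErasing ne zero    = nonErasing λ _ → s≤s z≤n
^ᴹ-nonErasing ne (suc n) = ∘ᴹ-nonErasing ne (^ᴹ-nonErasing ne n)

f-nonErasing : NonErasing f
f-nonErasing = nonErasing λ { zero → s≤s z≤n ; (suc zero) → s≤s z≤n ; (suc (suc zero)) → s≤s z≤n }

g-nonErasing : NonErasing g
g-nonErasing = nonErasing λ { zero → s≤s z≤n ; (suc zero) → s≤s z≤n ; (suc (suc zero)) → s≤s z≤n }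

h-nonErasing : NonErasing h
h-nonErasing = nonErasing λ { zero → s≤s z≤n ; (suc zero) → s≤s z≤n ; (suc (suc zero)) → s≤s z≤n }

ext-∘ᴹ : ∀ {a b c} (φ : Morphism b c) (ψ : Morphism a b) w → ext (φ ∘ᴹ ψ) w ≡ ext φ (ext ψ w)
ext-∘ᴹ φ ψ []      = refl
ext-∘ᴹ φ ψ (x ∷ w) = begin
  ext φ (ψ x) ++ ext (φ ∘ᴹ ψ) w   ≡⟨ cong (ext φ (ψ x) ++_) (ext-∘ᴹ φ ψ w) ⟩
  ext φ (ψ x) ++ ext φ (ext ψ w)  ≡⟨ concatMap-++ φ (ψ x) (ext ψ w) ⟨
  ext φ (ψ x ++ ext ψ w)          ∎

ext-^ᴹ-+ : ∀ {a} (φ : Morphism a a) m n w → ext (φ ^ᴹ (m + n)) w ≡ ext (φ ^ᴹ m) (ext (φ ^ᴹ n) w)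
ext-^ᴹ-+ φ zero    n w = sym (concatMap-pure (ext (φ ^ᴹ n) w))
ext-^ᴹ-+ φ (suc m) n w = begin
  ext (φ ∘ᴹ (φ ^ᴹ (m + n))) w            ≡⟨ ext-∘ᴹ φ (φ ^ᴹ (m + n)) w ⟩
  ext φ (ext (φ ^ᴹ (m + n)) w)           ≡⟨ cong (ext φ) (ext-^ᴹ-+ φ m n w) ⟩
  ext φ (ext (φ ^ᴹ m) (ext (φ ^ᴹ n) w))  ≡⟨ ext-∘ᴹ φ (φ ^ᴹ m) (ext (φ ^ᴹ n) w) ⟨
  ext (φ ∘ᴹ (φ ^ᴹ m)) (ext (φ ^ᴹ n) w)   ∎

length-factor : ∀ {k} (u : ωWord k) i m → length (factor u i m) ≡ m
length-factor u i m = trans (length-map _ (upTo m)) (length-upTo m)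

factor-suc : ∀ {k} (u : ωWord k) i m → factor u i (suc m) ≡ u i ∷ factor u (suc i) m
factor-suc u i m = cong₂ _∷_ (cong u (+-identityʳ i)) (begin
  map (λ j → u (i + j)) (applyUpTo suc m)   ≡⟨ cong (map _) (map-upTo suc m) ⟨
  map (λ j → u (i + j)) (map suc (upTo m))  ≡⟨ map-∘ (upTo m) ⟨
  map (λ j → u (i + suc j)) (upTo m)        ≡⟨ map-cong (λ j → cong u (+-suc i j)) (upTo m) ⟩
  factor u (suc i) m                        ∎)

factor-+ : ∀ {k} (u : ωWord k) i m n → factor u i (m + n) ≡ factor u i m ++ factor u (i + m) n
factor-+ u i zero    n = cong (λ j → factor u j n) (sym (+-identityʳ i))
factor-+ u i (suc m) n = begin
  factor u i (suc (m + n))                             ≡⟨ factor-suc u i (m + n) ⟩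
  u i ∷ factor u (suc i) (m + n)                       ≡⟨ cong (u i ∷_) (factor-+ u (suc i) m n) ⟩
  u i ∷ factor u (suc i) m ++ factor u (suc (i + m)) n
    ≡⟨ cong₂ (λ xs j → xs ++ factor u j n) (factor-suc u i m) (+-suc i m) ⟨
  factor u i (suc m) ++ factor u (i + suc m) n         ∎

drop-factor : ∀ {k} (u : ωWord k) i m p → drop p (factor u i m) ≡ factor u (i + p) (m ∸ p)
drop-factor u i m       zero    = cong (λ j → factor u j m) (sym (+-identityʳ i))
drop-factor u i zero    (suc p) = refl
drop-factor u i (suc m) (suc p) = begin
  drop (suc p) (factor u i (suc m))  ≡⟨ cong (drop (suc p)) (factor-suc u i m) ⟩
  drop p (factor u (suc i) m)        ≡⟨ drop-factor u (suc i) m p ⟩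
  factor u (suc (i + p)) (m ∸ p)     ≡⟨ cong (λ j → factor u j (m ∸ p)) (+-suc i p) ⟨
  factor u (i + suc p) (m ∸ p)       ∎

lookupD-factor : ∀ {k} (d : Σ k) (u : ωWord k) i m {j} → j < m → lookupD d (factor u i m) j ≡ u (i + j)
lookupD-factor d u i (suc m) {zero} _ = begin
  lookupD d (factor u i (suc m)) zero  ≡⟨ cong (λ w → lookupD d w zero) (factor-suc u i m) ⟩
  u i                                  ≡⟨ cong u (+-identityʳ i) ⟨
  u (i + zero)                         ∎
lookupD-factor d u i (suc m) {suc j} (s≤s j<m) = begin
  lookupD d (factor u i (suc m)) (suc j)  ≡⟨ cong (λ w → lookupD d w (suc j)) (factor-suc u i m) ⟩
  lookupD d (factor u (suc i) m) j        ≡⟨ lookupD-factor d u (suc i) m j<m ⟩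
  u (suc (i + j))                         ≡⟨ cong u (+-suc i j) ⟨
  u (i + suc j)                           ∎

factor-from-lookupD : ∀ {k} (u : ωWord k) (d : Σ k) i W →
  (∀ j → j < length W → u (i + j) ≡ lookupD d W j) → factor u i (length W) ≡ W
factor-from-lookupD u d i []      _     = refl
factor-from-lookupD u d i (x ∷ W) agree = trans (factor-suc u i (length W)) (cong₂ _∷_
  (trans (cong u (sym (+-identityʳ i))) (agree zero (s≤s z≤n)))
  (factor-from-lookupD u d (suc i) W λ j j<W → trans (cong u (sym (+-suc i j))) (agree (suc j) (s≤s j<W))))

factor-infix : ∀ {k} (u : ωWord k) i m {A R B : Word k} →
  factor u i m ≡ A ++ R ++ B → factor u (i + length A) (length R) ≡ R
factor-infix u i m {A} {R} {B} eq =
  proj₁ (++-cancel-≡length (factor u (i + length A) (length R)) R (length-factor u _ (length R))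
    (proj₂ (++-cancel-≡length (factor u i (length A)) A (length-factor u i (length A))
      (trans (sym split) eq))))
  where
  m≡ : m ≡ length A + (length R + length B)
  m≡ = begin
    m                                   ≡⟨ length-factor u i m ⟨
    length (factor u i m)               ≡⟨ cong length eq ⟩
    length (A ++ R ++ B)                ≡⟨ length-++ A ⟩
    length A + length (R ++ B)          ≡⟨ cong (length A +_) (length-++ R) ⟩
    length A + (length R + length B)    ∎
  split : factor u i m ≡ factor u i (length A) ++ factor u (i + length A) (length R)
                           ++ factor u (i + length A + length R) (length B)
  split = begin
    factor u i m                                    ≡⟨ cong (factor u i) m≡ ⟩
    factor u i (length A + (length R + length B))   ≡⟨ factor-+ u i (length A) _ ⟩
    factor u i (length A) ++ factor u (i + length A) (length R + length B)
      ≡⟨ cong (factor u i (length A) ++_) (factor-+ u (i + length A) (length R) (length B)) ⟩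
    factor u i (length A) ++ factor u (i + length A) (length R)
      ++ factor u (i + length A + length R) (length B)  ∎

module _ {a b} {φ : Morphism a b} (ne : NonErasing φ) (d : Σ b) (u : ωWord a) where

  private
    U : ωWord b
    U = applyω φ d u

  lookupD-ext-prefix-+ : ∀ m n {j} → j < length (ext φ (prefix u m)) →
    lookupD d (ext φ (prefix u (m + n))) j ≡ lookupD d (ext φ (prefix u m)) j
  lookupD-ext-prefix-+ m n {j} j< = begin
    lookupD d (ext φ (prefix u (m + n))) j
      ≡⟨ cong (λ w → lookupD d (ext φ w) j) (factor-+ u 0 m n) ⟩
    lookupD d (ext φ (prefix u m ++ factor u m n)) j
      ≡⟨ cong (λ w → lookupD d w j) (concatMap-++ φ (prefix u m) (factor u m n)) ⟩
    lookupD d (ext φ (prefix u m) ++ ext φ (factor u m n)) j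
      ≡⟨ lookupD-++ˡ d (ext φ (prefix u m)) _ j< ⟩
    lookupD d (ext φ (prefix u m)) j  ∎

  applyω-lookupD : ∀ N {j} → j < length (ext φ (prefix u N)) →
    U j ≡ lookupD d (ext φ (prefix u N)) j
  applyω-lookupD N {j} j< = begin
    lookupD d (ext φ (prefix u (suc j))) j      ≡⟨ lookupD-ext-prefix-+ (suc j) N j<image ⟨
    lookupD d (ext φ (prefix u (suc j + N))) j  ≡⟨ cong (λ m → lookupD d (ext φ (prefix u m)) j) (+-comm (suc j) N) ⟩
    lookupD d (ext φ (prefix u (N + suc j))) j  ≡⟨ lookupD-ext-prefix-+ N (suc j) j< ⟩
    lookupD d (ext φ (prefix u N)) j            ∎
    where
    j<image : j < length (ext φ (prefix u (suc j)))
    j<image = ≤-trans (≤-reflexive (sym (length-factor u 0 (suc j)))) (length-ext ne (prefix u (suc j)))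

  prefix-applyω : ∀ N → prefix U (length (ext φ (prefix u N))) ≡ ext φ (prefix u N)
  prefix-applyω N = factor-from-lookupD U d 0 (ext φ (prefix u N)) λ j → applyω-lookupD N

  factor-applyω : ∀ i v → factor u i (length v) ≡ v →
    factor U (length (ext φ (prefix u i))) (length (ext φ v)) ≡ ext φ v
  factor-applyω i v occ =
    proj₂ (++-cancel-≡length (prefix U (length Q)) Q (length-factor U 0 (length Q)) (begin
      prefix U (length Q) ++ factor U (length Q) (length (ext φ v))  ≡⟨ factor-+ U 0 (length Q) _ ⟨
      prefix U (length Q + length (ext φ v))                         ≡⟨ cong (prefix U) (length-++ Q) ⟨
      prefix U (length (Q ++ ext φ v))                               ≡⟨ image-prefix ⟩
      Q ++ ext φ v                                                   ∎))
    where
    Q = ext φ (prefix u i)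
    prefix-image : ext φ (prefix u (i + length v)) ≡ Q ++ ext φ v
    prefix-image = begin
      ext φ (prefix u (i + length v))              ≡⟨ cong (ext φ) (factor-+ u 0 i (length v)) ⟩
      ext φ (prefix u i ++ factor u i (length v))  ≡⟨ cong (λ w → ext φ (prefix u i ++ w)) occ ⟩
      ext φ (prefix u i ++ v)                      ≡⟨ concatMap-++ φ (prefix u i) v ⟩
      Q ++ ext φ v                                 ∎
    image-prefix : prefix U (length (Q ++ ext φ v)) ≡ Q ++ ext φ v
    image-prefix = subst (λ W → prefix U (length W) ≡ W) prefix-image (prefix-applyω (i + length v))

Periodic : ∀ {k} → ℕ → Word k → Set
Periodic p R = Prefix _≡_ (drop p R) R

Power≥14/5 : ∀ {k} → ℕ → Word k → Set
Power≥14/5 p R = Periodic p R × 1 ≤ p × 14 * p ≤ 5 * length R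

ContainsPower≥14/5 : ∀ {k} → Word k → Set
ContainsPower≥14/5 E = ∃ λ A → ∃ λ R → ∃ λ B → ∃ λ p → E ≡ A ++ R ++ B × Power≥14/5 p R

Cube : ∀ {k} → Word k → Set
Cube W = ∃ λ P → ∃ λ x → ∃ λ S → W ≡ P ++ (x ++ x ++ x) ++ S × 1 ≤ length x

power≥14/5-nonempty : ∀ {k p} (R : Word k) → Power≥14/5 p R → 1 ≤ length R
power≥14/5-nonempty []      (_ , 1≤p , 14p≤5R) = contradiction (≤-trans (*-monoʳ-≤ 14 1≤p) 14p≤5R) λ ()
power≥14/5-nonempty (_ ∷ _) _                  = s≤s z≤n

cube⇒power≥14/5 : ∀ {k} {W : Word k} → Cube W → ContainsPower≥14/5 W
cube⇒power≥14/5 (P , x , S , eq , 1≤x) =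
  P , x ++ x ++ x , S , length x , eq , periodic , 1≤x , 14x≤5xxx
  where
  periodic : Periodic (length x) (x ++ x ++ x)
  periodic = subst₂ (Prefix _≡_) (sym (drop-length-++ x)) (++-assoc x x x)
    (fromPointwise (≡⇒Pointwise-≡ refl) ++ᵖ x)
  15y≡5[y+y+y] : ∀ y → 15 * y ≡ 5 * (y + (y + y))
  15y≡5[y+y+y] = solve-∀
  14x≤5xxx : 14 * length x ≤ 5 * length (x ++ x ++ x)
  14x≤5xxx = ≤-trans (*-monoˡ-≤ (length x) (n≤1+n 14)) (≤-reflexive (begin
    15 * length x                          ≡⟨ 15y≡5[y+y+y] (length x) ⟩
    5 * (length x + (length x + length x)) ≡⟨ cong (λ n → 5 * (length x + n)) (length-++ x) ⟨
    5 * (length x + length (x ++ x))       ≡⟨ cong (5 *_) (length-++ x) ⟨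
    5 * length (x ++ x ++ x)               ∎))

cube-ext : ∀ {a b} {ψ : Morphism a b} → NonErasing ψ → ∀ {W} → Cube W → Cube (ext ψ W)
cube-ext {ψ = ψ} ne (P , x , S , refl , 1≤x) =
  ext ψ P , ext ψ x , ext ψ S , image , ≤-trans 1≤x (length-ext ne x)
  where
  xxx : ext ψ (x ++ x ++ x) ≡ ext ψ x ++ ext ψ x ++ ext ψ x
  xxx = trans (concatMap-++ ψ x (x ++ x)) (cong (ext ψ x ++_) (concatMap-++ ψ x x))
  image : ext ψ (P ++ (x ++ x ++ x) ++ S) ≡ ext ψ P ++ (ext ψ x ++ ext ψ x ++ ext ψ x) ++ ext ψ S
  image = begin
    ext ψ (P ++ (x ++ x ++ x) ++ S)              ≡⟨ concatMap-++ ψ P _ ⟩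
    ext ψ P ++ ext ψ ((x ++ x ++ x) ++ S)        ≡⟨ cong (ext ψ P ++_) (concatMap-++ ψ (x ++ x ++ x) S) ⟩
    ext ψ P ++ ext ψ (x ++ x ++ x) ++ ext ψ S    ≡⟨ cong (λ X → ext ψ P ++ X ++ ext ψ S) xxx ⟩
    ext ψ P ++ (ext ψ x ++ ext ψ x ++ ext ψ x) ++ ext ψ S  ∎

periodic⇒hasPeriod : ∀ {k} (u : ωWord k) s m p → Periodic p (factor u s m) → HasPeriod u s m p
periodic⇒hasPeriod u s m p periodic j j+p<m = begin
  u (s + j)                               ≡⟨ lookupD-factor (u s) u s r j<r ⟨
  lookupD (u s) (factor u s r) j          ≡⟨ cong (λ w → lookupD (u s) w j) shifted ⟨
  lookupD (u s) (factor u (s + p) r) j    ≡⟨ lookupD-factor (u s) u (s + p) r j<r ⟩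
  u (s + p + j)                           ≡⟨ cong u (+-assoc s p j) ⟩
  u (s + (p + j))                         ≡⟨ cong (λ n → u (s + n)) (+-comm p j) ⟩
  u (s + (j + p))                         ≡⟨ cong u (+-assoc s j p) ⟨
  u (s + j + p)                           ∎
  where
  r = m ∸ p
  j<r : j < r
  j<r = m+n≤o⇒m≤o∸n (suc j) j+p<m
  p≤m : p ≤ m
  p≤m = ≤-trans (m≤n+m p (suc j)) j+p<m
  shifted : factor u (s + p) r ≡ factor u s r
  shifted with t , R≡ ← prefix⇒++ periodic =
    proj₁ (++-cancel-≡length (factor u (s + p) r) (factor u s r)
      (trans (length-factor u (s + p) r) (sym (length-factor u s r))) (begin
        factor u (s + p) r ++ t             ≡⟨ cong (_++ t) (drop-factor u s m p) ⟨
        drop p (factor u s m) ++ t          ≡⟨ R≡ ⟨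
        factor u s m                        ≡⟨ cong (factor u s) (m∸n+n≡m p≤m) ⟨
        factor u s (r + p)                  ≡⟨ factor-+ u s r p ⟩
        factor u s r ++ factor u (s + r) p  ∎))

free⇒¬power≥14/5-factor : ∀ {k} (u : ωWord k) → Free-14/5 u → ∀ i m → ¬ ContainsPower≥14/5 (factor u i m)
free⇒¬power≥14/5-factor u free i m (A , R , B , p , eq , power@(periodic , 1≤p , 14p≤5R)) =
  <⇒≱ (free (i + length A) (length R) p (power≥14/5-nonempty R power) 1≤p hasPeriod) 14p≤5R
  where
  hasPeriod : HasPeriod u (i + length A) (length R) p
  hasPeriod = periodic⇒hasPeriod u (i + length A) (length R) p
    (subst (Periodic p) (sym (factor-infix u i m {A} {R} {B} eq)) periodic)

bordered : ∀ {k} → Σ k → Word k → Σ k → Word k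
bordered a w b = a ∷ w ++ b ∷ []

⌈14_/5⌉ : ℕ → ℕ
⌈14 p /5⌉ = (14 * p + 4) / 5

PowerAt : ∀ {k} → ℕ → ℕ → Word k → Set
PowerAt p o E = Power≥14/5 p (take ⌈14 p /5⌉ (drop o E))

powerAt? : ∀ {k} p o (E : Word k) → Dec (PowerAt p o E)
powerAt? p o E = prefix? _≟ᶠ_ (drop p R) R ×-dec (1 ≤? p ×-dec 14 * p ≤? 5 * length R)
  where R = take ⌈14 p /5⌉ (drop o E)

powerAt⇒power≥14/5 : ∀ {k} p o (E : Word k) → PowerAt p o E → ContainsPower≥14/5 E
powerAt⇒power≥14/5 p o E power = take o E , R , drop m (drop o E) , p , split , power
  where
  m = ⌈14 p /5⌉
  R = take m (drop o E)
  split : E ≡ take o E ++ R ++ drop m (drop o E)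
  split = sym (trans (cong (take o E ++_) (take++drop≡id m (drop o E))) (take++drop≡id o E))

CubeAt : ∀ {k} → ℕ → ℕ → Word k → Set
CubeAt p o W = Prefix _≡_ (x ++ x ++ x) (drop o W) × 1 ≤ length x
  where x = take p (drop o W)

cubeAt? : ∀ {k} p o (W : Word k) → Dec (CubeAt p o W)
cubeAt? p o W = prefix? _≟ᶠ_ (x ++ x ++ x) (drop o W) ×-dec 1 ≤? length x
  where x = take p (drop o W)

cubeAt⇒cube : ∀ {k} p o (W : Word k) → CubeAt p o W → Cube W
cubeAt⇒cube p o W (cube , 1≤x) with S , suffix ← prefix⇒++ cube =
  take o W , x , S , trans (sym (take++drop≡id o W)) (cong (take o W ++_) suffix) , 1≤x
  where x = take p (drop o W)

-- A period p and, for a = 0, 1, 2, the position of a repetition of period p in ψ(a w b)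
-- for every b; certificates for the words of F are listed in the order of F.
Certificate : Set
Certificate = ℕ × ℕ × ℕ × ℕ

period : Certificate → ℕ
period (p , _) = p

position : Certificate → Σ 3 → ℕ
position (_ , o , _ , _) zero             = o
position (_ , _ , o , _) (suc zero)       = o
position (_ , _ , _ , o) (suc (suc zero)) = o

module Certified {k} (ψ : Morphism 3 k) {Found : Word k → Set}
                 (FoundAt : ℕ → ℕ → Word k → Set)
                 (foundAt? : ∀ p o W → Dec (FoundAt p o W))
                 (sound : ∀ p o W → FoundAt p o W → Found W) where

  Certifies : Certificate → Word 3 → Set
  Certifies c w = ∀ a b → FoundAt (period c) (position c a) (ext ψ (bordered a w b))

  certifies? : ∀ c w → Dec (Certifies c w)
  certifies? c w = all? λ a → all? λ b → foundAt? (period c) (position c a) (ext ψ (bordered a w b))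

  certified : (cs : List Certificate) → {True (pointwise? certifies? cs F)} →
              ∀ w → w ∈ F → ∀ a b → Found (ext ψ (bordered a w b))
  certified cs {ok} w w∈F a b = sound _ _ _ (proj₂ (pointwise-∈ʳ (toWitness ok) w∈F) a b)

PowersInBorderedImages : Morphism 3 2 → Set
PowersInBorderedImages φ = ∀ w → w ∈ F → ∀ a b → ContainsPower≥14/5 (ext φ (bordered a w b))

module Powers (φ : Morphism 3 2) = Certified φ PowerAt powerAt? powerAt⇒power≥14/5
module Cubes = Certified (h ^ᴹ 3) CubeAt cubeAt? cubeAt⇒cube

f∘g∘h¹-powers : PowersInBorderedImages (f ∘ᴹ (g ∘ᴹ (h ^ᴹ 1)))
f∘g∘h¹-powers = Powers.certified (f ∘ᴹ (g ∘ᴹ (h ^ᴹ 1)))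
  ((31 , 15 , 20 , 33) ∷ (13 , 6 , 11 , 24) ∷ (31 , 6 , 11 , 24) ∷ (18 , 28 , 33 , 46) ∷ (18 , 6 , 11 , 24) ∷ [])

f∘g∘h²-powers : PowersInBorderedImages (f ∘ᴹ (g ∘ᴹ (h ^ᴹ 2)))
f∘g∘h²-powers = Powers.certified (f ∘ᴹ (g ∘ᴹ (h ^ᴹ 2)))
  ((75 , 37 , 50 , 81) ∷ (31 , 15 , 28 , 59) ∷ (75 , 15 , 28 , 59) ∷ (44 , 68 , 81 , 112) ∷ (44 , 15 , 28 , 59) ∷ [])

f∘h¹-powers : PowersInBorderedImages (f ∘ᴹ (h ^ᴹ 1))
f∘h¹-powers = Powers.certified (f ∘ᴹ (h ^ᴹ 1))
  ((7 , 4 , 5 , 8) ∷ (3 , 2 , 3 , 6) ∷ (7 , 2 , 3 , 6) ∷ (4 , 7 , 8 , 11) ∷ (4 , 2 , 3 , 6) ∷ [])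

f∘h²-powers : PowersInBorderedImages (f ∘ᴹ (h ^ᴹ 2))
f∘h²-powers = Powers.certified (f ∘ᴹ (h ^ᴹ 2))
  ((17 , 9 , 12 , 19) ∷ (7 , 4 , 7 , 14) ∷ (17 , 4 , 7 , 14) ∷ (10 , 16 , 19 , 26) ∷ (10 , 4 , 7 , 14) ∷ [])

h³-cubes : ∀ w → w ∈ F → ∀ a b → Cube (ext (h ^ᴹ 3) (bordered a w b))
h³-cubes = Cubes.certified
  ((20 , 12 , 15 , 23) ∷ (9 , 6 , 9 , 17) ∷ (21 , 6 , 9 , 17) ∷ (12 , 20 , 23 , 31) ∷ (12 , 6 , 9 , 17) ∷ [])

powers-from-h³-cubes : (φ ψ : Morphism 3 2) → NonErasing ψ → ∀ k →
  (∀ v → ext φ v ≡ ext ψ (ext (h ^ᴹ (3 + k)) v)) → PowersInBorderedImages φ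
powers-from-h³-cubes φ ψ ne k image w w∈F a b =
  subst ContainsPower≥14/5 (sym (trans (image v) split))
    (cube⇒power≥14/5 (cube-ext ne′ {ext (h ^ᴹ 3) v} (h³-cubes w w∈F a b)))
  where
  v = bordered a w b
  ne′ : NonErasing (ψ ∘ᴹ (h ^ᴹ k))
  ne′ = ∘ᴹ-nonErasing ne (^ᴹ-nonErasing h-nonErasing k)
  split : ext ψ (ext (h ^ᴹ (3 + k)) v) ≡ ext (ψ ∘ᴹ (h ^ᴹ k)) (ext (h ^ᴹ 3) v)
  split = begin
    ext ψ (ext (h ^ᴹ (3 + k)) v)             ≡⟨ cong (λ n → ext ψ (ext (h ^ᴹ n) v)) (+-comm 3 k) ⟩
    ext ψ (ext (h ^ᴹ (k + 3)) v)             ≡⟨ cong (ext ψ) (ext-^ᴹ-+ h k 3 v) ⟩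
    ext ψ (ext (h ^ᴹ k) (ext (h ^ᴹ 3) v))    ≡⟨ ext-∘ᴹ ψ (h ^ᴹ k) (ext (h ^ᴹ 3) v) ⟨
    ext (ψ ∘ᴹ (h ^ᴹ k)) (ext (h ^ᴹ 3) v)     ∎

f∘g∘hⁿ-powers : ∀ n → 1 ≤ n → PowersInBorderedImages (f ∘ᴹ (g ∘ᴹ (h ^ᴹ n)))
f∘g∘hⁿ-powers 1                   _ = f∘g∘h¹-powers
f∘g∘hⁿ-powers 2                   _ = f∘g∘h²-powers
f∘g∘hⁿ-powers n@(suc (suc (suc k))) _ =
  powers-from-h³-cubes _ (f ∘ᴹ g) (∘ᴹ-nonErasing f-nonErasing g-nonErasing) k λ v → begin
    ext (f ∘ᴹ (g ∘ᴹ (h ^ᴹ n))) v        ≡⟨ ext-∘ᴹ f (g ∘ᴹ (h ^ᴹ n)) v ⟩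
    ext f (ext (g ∘ᴹ (h ^ᴹ n)) v)       ≡⟨ cong (ext f) (ext-∘ᴹ g (h ^ᴹ n) v) ⟩
    ext f (ext g (ext (h ^ᴹ n) v))      ≡⟨ ext-∘ᴹ f g (ext (h ^ᴹ n) v) ⟨
    ext (f ∘ᴹ g) (ext (h ^ᴹ n) v)       ∎

f∘hⁿ-powers : ∀ n → 1 ≤ n → PowersInBorderedImages (f ∘ᴹ (h ^ᴹ n))
f∘hⁿ-powers 1                   _ = f∘h¹-powers
f∘hⁿ-powers 2                   _ = f∘h²-powers
f∘hⁿ-powers n@(suc (suc (suc k))) _ = powers-from-h³-cubes _ f f-nonErasing k (ext-∘ᴹ f (h ^ᴹ n))

factor-bordered : ∀ {k} (u : ωWord k) i w → factor u (suc i) (length w) ≡ w →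
  let b = u (suc i + length w) in factor u i (length (bordered (u i) w b)) ≡ bordered (u i) w b
factor-bordered u i w occ = begin
  factor u i (suc (length (w ++ b ∷ [])))   ≡⟨ cong (λ m → factor u i (suc m)) (length-++ w) ⟩
  factor u i (suc (length w + 1))           ≡⟨ factor-suc u i _ ⟩
  u i ∷ factor u (suc i) (length w + 1)     ≡⟨ cong (u i ∷_) (factor-+ u (suc i) (length w) 1) ⟩
  u i ∷ factor u (suc i) (length w) ++ factor u (suc i + length w) 1
    ≡⟨ cong₂ (λ x y → u i ∷ x ++ y) occ (factor-suc u (suc i + length w) 0) ⟩
  u i ∷ w ++ b ∷ []                         ∎
  where b = u (suc i + length w)

free-image⇒suffixAvoidsF : (φ : Morphism 3 2) → NonErasing φ → PowersInBorderedImages φ →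
  ∀ u → Free-14/5 (applyω φ l0 u) → SuffixAvoidsF u
-- Starting the suffix at position 1 gives every occurrence a left neighbour.
free-image⇒suffixAvoidsF φ ne powers u free = 1 , avoids
  where
  avoids : ∀ w → w ∈ F → ∀ i → 1 ≤ i → ¬ (factor u i (length w) ≡ w)
  avoids w w∈F (suc i) _ occ = free⇒¬power≥14/5-factor U free _ _ power-in-image
    where
    U = applyω φ l0 u
    v = bordered (u i) w (u (suc i + length w))
    power-in-image : ContainsPower≥14/5 (factor U (length (ext φ (prefix u i))) (length (ext φ v)))
    power-in-image = subst ContainsPower≥14/5 (sym (factor-applyω ne l0 u i v (factor-bordered u i w occ)))
      (powers w w∈F (u i) (u (suc i + length w)))

lemma10 : (u : ωWord 3) (n : ℕ) → 1 ≤ n →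
    Good (applyω (f ∘ᴹ (g ∘ᴹ (h ^ᴹ n))) l0 u) ⊎ Good (applyω (f ∘ᴹ (h ^ᴹ n)) l0 u) →
    SuffixAvoidsF u
lemma10 u n 1≤n (inj₁ (_ , free)) =
  free-image⇒suffixAvoidsF (f ∘ᴹ (g ∘ᴹ (h ^ᴹ n)))
    (∘ᴹ-nonErasing f-nonErasing (∘ᴹ-nonErasing g-nonErasing (^ᴹ-nonErasing h-nonErasing n)))
    (f∘g∘hⁿ-powers n 1≤n) u free
lemma10 u n 1≤n (inj₂ (_ , free)) =
  free-image⇒suffixAvoidsF (f ∘ᴹ (h ^ᴹ n)) (∘ᴹ-nonErasing f-nonErasing (^ᴹ-nonErasing h-nonErasing n))
    (f∘hⁿ-powers n 1≤n) u free
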